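{- Let $\mathbb{B}$ be a complete Boolean algebra. For all $u,v\in\mathbf{V}^{(\mathbb{B})}$: (i) $\llbracket u=v\rrbracket_{\mathrm{PA}}=\llbracket u=v\rrbracket_{\mathrm{BA}}$, and (ii) $\llbracket u\in v\rrbracket_{\mathrm{PA}}=\llbracket u\in v\rrbracket_{\mathrm{BA}}$.
   Context: For a complete Boolean algebra $\mathbb{B}=\langle\mathbf{B},\wedge,\vee,\Rightarrow,{}^*,\mathbf{1},\mathbf{0}\rangle$ ($\Rightarrow$ Boolean implication, ${}^*$ complement), $\mathbf{V}^{(\mathbb{B})}=\bigcup_\alpha\mathbf{V}^{(\mathbb{B})}_\alpha$, where $\mathbf{V}^{(\mathbb{B})}_\alpha$ is the set of functions with range in $\mathbf{B}$ and domain contained in some $\mathbf{V}^{(\mathbb{B})}_\xi$, $\xi<\alpha$. Recursively: $\llbracket u\in v\rrbracket_X=\bigvee_{x\in\mathrm{dom}(v)}(v(x)\wedge\llbracket x=u\rrbracket_X)$ for $X\in\{\mathrm{BA},\mathrm{PA}\}$; $\llbracket u=v\rrbracket_{\mathrm{BA}}=\bigwedge_{x\in\mathrm{dom}(u)}(u(x)\Rightarrow\llbracket x\in v\rrbracket_{\mathrm{BA}})\wedge\bigwedge_{y\in\mathrm{dom}(v)}(v(y)\Rightarrow\llbracket y\in u\rrbracket_{\mathrm{BA}})$; $\llbracket u=v\rrbracket_{\mathrm{PA}}=\bigwedge_{x\in\mathrm{dom}(u)}((u(x)\Rightarrow\llbracket x\in v\rrbracket_{\mathrm{PA}})\wedge(\llbracket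 x\in v\rrbracket_{\mathrm{PA}}^*\Rightarrow u(x)^*))\wedge\bigwedge_{y\in\mathrm{dom}(v)}((v(y)\Rightarrow\llbracket y\in u\rrbracket_{\mathrm{PA}})\wedge(\llbracket y\in u\rrbracket_{\mathrm{PA}}^*\Rightarrow v(y)^*))$. -}

module Defs where

open import Level using (Level; _⊔_) renaming (suc to lsuc; zero to lzero)
open import Data.Product using (_×_; _,_)
open import Algebra.Lattice.Bundles using (BooleanAlgebra)

record CompleteBooleanAlgebra (c ℓ : Level) : Set (lsuc (c ⊔ ℓ)) where
  field
    booleanAlgebra : BooleanAlgebra c ℓ
  open BooleanAlgebra booleanAlgebra public
  _≤_ : Carrier → Carrier → Set ℓ
  x ≤ y = (x ∧ y) ≈ x
  field
    ⋁ : {I : Set} → (I → Carrier) → Carrier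
    ⋁-upper : {I : Set} (f : I → Carrier) (i : I) → f i ≤ ⋁ f
    ⋁-least : {I : Set} (f : I → Carrier) (b : Carrier) → (∀ i → f i ≤ b) → ⋁ f ≤ b
    ⋀ : {I : Set} → (I → Carrier) → Carrier
    ⋀-lower : {I : Set} (f : I → Carrier) (i : I) → ⋀ f ≤ f i
    ⋀-greatest : {I : Set} (f : I → Carrier) (b : Carrier) → (∀ i → b ≤ f i) → b ≤ ⋀ f
  _⇒_ : Carrier → Carrier → Carrier
  x ⇒ y = (¬ x) ∨ y

-- Boolean-valued names: a name u is given by a domain (an index type dom),
-- the elements of the domain (elt : dom → Name) and their values (val : dom → B).
module _ {c ℓ : Level} (𝔹 : CompleteBooleanAlgebra c ℓ) where
  open CompleteBooleanAlgebra 𝔹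

  data Name : Set (lsuc lzero ⊔ c) where
    mkName : (dom : Set) → (elt : dom → Name) → (val : dom → Carrier) → Name

  mutual
    memBA : Name → Name → Carrier
    memBA u (mkName J y w) = ⋁ (λ j → w j ∧ eqBA (y j) u)

    eqBA : Name → Name → Carrier
    eqBA (mkName I x v) (mkName J y w) =
      ⋀ (λ i → v i ⇒ memBA (x i) (mkName J y w)) ∧
      ⋀ (λ j → w j ⇒ memBA (y j) (mkName I x v))

  mutual
    memPA : Name → Name → Carrier
    memPA u (mkName J y w) = ⋁ (λ j → w j ∧ eqPA (y j) u)

    eqPA : Name → Name → Carrier
    eqPA (mkName I x v) (mkName J y w) =
      ⋀ (λ i → (v i ⇒ memPA (x i) (mkName J y w)) ∧ ((¬ memPA (x i) (mkName J y w)) ⇒ (¬ v i))) ∧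
      ⋀ (λ j → (w j ⇒ memPA (y j) (mkName I x v)) ∧ ((¬ memPA (y j) (mkName I x v)) ⇒ (¬ w j)))

{-# OPTIONS --safe #-}
-- Each PA clause is the corresponding BA clause a ⇒ b conjoined with its
-- contrapositive ¬ b ⇒ ¬ a, which in a Boolean algebra equals a ⇒ b; so the
-- two semantics agree by simultaneous induction on names.
module Submission where

open import Defs
open import Level using (Level)
open import Data.Product using (_×_; _,_)
import Algebra.Lattice.Properties.BooleanAlgebra as BooleanAlgebraProperties
import Algebra.Lattice.Properties.Lattice as LatticeProperties
open import Relation.Binary.Bundles using (Poset)
import Relation.Binary.Reasoning.Setoid as SetoidReasoning

module CompleteBooleanAlgebraProperties {c ℓ : Level} (𝔹 : CompleteBooleanAlgebra c ℓ) where
  open CompleteBooleanAlgebra 𝔹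
  open BooleanAlgebraProperties booleanAlgebra using (¬-involutive; ∧-idem)
  open SetoidReasoning setoid

  ≤-antisym : ∀ {x y} → x ≤ y → y ≤ x → x ≈ y
  ≤-antisym x≤y y≤x = Poset.antisym (LatticeProperties.poset lattice) (sym x≤y) (sym y≤x)

  ≤-respˡ-≈ : ∀ {x y z} → x ≈ y → y ≤ z → x ≤ z
  ≤-respˡ-≈ {x} {y} {z} x≈y y≤z = begin
    x ∧ z ≈⟨ ∧-congʳ x≈y ⟩
    y ∧ z ≈⟨ y≤z ⟩
    y     ≈⟨ x≈y ⟨
    x     ∎

  ≤-respʳ-≈ : ∀ {x y z} → y ≈ z → x ≤ y → x ≤ z
  ≤-respʳ-≈ y≈z x≤y = trans (∧-congˡ (sym y≈z)) x≤y

  ⋁-cong : {I : Set} {f g : I → Carrier} → (∀ i → f i ≈ g i) → ⋁ f ≈ ⋁ g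
  ⋁-cong {f = f} {g} f≈g = ≤-antisym
    (⋁-least f (⋁ g) (λ i → ≤-respˡ-≈ (f≈g i) (⋁-upper g i)))
    (⋁-least g (⋁ f) (λ i → ≤-respˡ-≈ (sym (f≈g i)) (⋁-upper f i)))

  ⋀-cong : {I : Set} {f g : I → Carrier} → (∀ i → f i ≈ g i) → ⋀ f ≈ ⋀ g
  ⋀-cong {f = f} {g} f≈g = ≤-antisym
    (⋀-greatest g (⋀ f) (λ i → ≤-respʳ-≈ (f≈g i) (⋀-lower f i)))
    (⋀-greatest f (⋀ g) (λ i → ≤-respʳ-≈ (sym (f≈g i)) (⋀-lower g i)))

  ⇒-congˡ : ∀ {x y z} → y ≈ z → (x ⇒ y) ≈ (x ⇒ z)
  ⇒-congˡ = ∨-congˡ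

  ⇒-contrapositive : ∀ x y → ((¬ y) ⇒ (¬ x)) ≈ (x ⇒ y)
  ⇒-contrapositive x y = begin
    ¬ ¬ y ∨ ¬ x ≈⟨ ∨-congʳ (¬-involutive y) ⟩
    y ∨ ¬ x     ≈⟨ ∨-comm y (¬ x) ⟩
    ¬ x ∨ y     ∎

  ⇒-∧-contrapositive : ∀ x y → ((x ⇒ y) ∧ ((¬ y) ⇒ (¬ x))) ≈ (x ⇒ y)
  ⇒-∧-contrapositive x y = begin
    (x ⇒ y) ∧ ((¬ y) ⇒ (¬ x)) ≈⟨ ∧-congˡ (⇒-contrapositive x y) ⟩
    (x ⇒ y) ∧ (x ⇒ y)         ≈⟨ ∧-idem (x ⇒ y) ⟩
    x ⇒ y                     ∎

module _ {c ℓ : Level} (𝔹 : CompleteBooleanAlgebra c ℓ) where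
  open CompleteBooleanAlgebra 𝔹
  open CompleteBooleanAlgebraProperties 𝔹

  mutual
    eqPA≈eqBA : ∀ u v → eqPA 𝔹 u v ≈ eqBA 𝔹 u v
    eqPA≈eqBA u@(mkName I x a) v@(mkName J y b) = ∧-cong
      (⋀-cong λ i → trans (⇒-∧-contrapositive (a i) (memPA 𝔹 (x i) v))
                          (⇒-congˡ (memPA≈memBA (x i) v)))
      (⋀-cong λ j → trans (⇒-∧-contrapositive (b j) (memPA 𝔹 (y j) u))
                          (⇒-congˡ (memPA≈memBA (y j) u)))

    memPA≈memBA : ∀ u v → memPA 𝔹 u v ≈ memBA 𝔹 u v
    memPA≈memBA u (mkName J y b) = ⋁-cong λ j → ∧-congˡ (eqPA≈eqBA (y j) u)

mainTheorem20 : {c ℓ : Level} (𝔹 : CompleteBooleanAlgebra c ℓ) (u v : Name 𝔹) →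
    CompleteBooleanAlgebra._≈_ 𝔹 (eqPA 𝔹 u v) (eqBA 𝔹 u v) ×
    CompleteBooleanAlgebra._≈_ 𝔹 (memPA 𝔹 u v) (memBA 𝔹 u v)
mainTheorem20 𝔹 u v = eqPA≈eqBA 𝔹 u v , memPA≈memBA 𝔹 u v
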